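{- For every tree $T$ on $n\geq 3$ vertices, $$\mu(\mathrm{Cone}(S_n)) \geq \mu(\mathrm{Cone}(T)) \geq \mu(\mathrm{Cone}(P_n)),$$ and moreover $\mu(\mathrm{Cone}(S_n)) = n-2$ and $\mu(\mathrm{Cone}(P_n))=1$.
   Context: For a finite connected graph $G=(V,E)$ (parallel edges allowed, no loops), the Laplacian $L_G \in \mathbb{Z}^{V\times V}$ has $(v,v)$-entry $\deg_G(v)$ and $(v,v')$-entry equal to minus the number of edges between $v$ and $v'$ for $v\neq v'$. For a root vertex $v_0$, $\overline{L}_G$ is $L_G$ with the row and column of $v_0$ deleted, and the sandpile group is $K(G)=\mathbb{Z}^{V-\{v_0\}}/\operatorname{im}\overline{L}_G$ (independent of $v_0$ up to isomorphism); $\mu(G)$ is the minimal number of generators of $K(G)$. For a tree $T$, $\mathrm{Cone}(T)$ is obtained by adding a new vertex $v_0$ joined by one edge to each vertex of $T$. $P_n$ denotes the path on $n$ vertices and $S_n=K_{1,n-1}$ the star on $n$ vertices (one central vertex adjacent to $n-1$ leaves). -}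

module Defs where

open import Data.Nat as ℕ using (ℕ; zero; suc; _≤_; _<_; _≡ᵇ_)
open import Data.Fin using (Fin; zero; suc; toℕ; _≟_)
open import Data.Integer as ℤ using (ℤ; +_; -_; _-_)
open import Data.Bool using (Bool; true; false; if_then_else_; _∨_; _xor_)
open import Data.List using (List; []; _∷_; _++_; [_]; length)
open import Data.List.Relation.Unary.Unique.Propositional using (Unique)
open import Data.Product using (Σ; ∃; _×_; _,_)
open import Data.Unit using (⊤)
open import Relation.Nullary using (¬_; does)
open import Relation.Binary.PropositionalEquality using (_≡_)

∑ : (m : ℕ) → (Fin m → ℤ) → ℤ
∑ zero    f = + 0
∑ (suc m) f = f zero ℤ.+ ∑ m (λ i → f (suc i))

∑ℕ : (m : ℕ) → (Fin m → ℕ) → ℕ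
∑ℕ zero    f = 0
∑ℕ (suc m) f = f zero ℕ.+ ∑ℕ m (λ i → f (suc i))

-- A (multi)graph on vertex set Fin m, given by its edge-multiplicity matrix:
-- G u v = number of edges between u and v.
MGraph : ℕ → Set
MGraph m = Fin m → Fin m → ℕ

IsMultigraph : {m : ℕ} → MGraph m → Set
IsMultigraph {m} G = (∀ u v → G u v ≡ G v u) × (∀ u → G u u ≡ 0)

IsSimpleGraph : {m : ℕ} → MGraph m → Set
IsSimpleGraph {m} G = IsMultigraph G × (∀ u v → G u v ≤ 1)

Adj : {m : ℕ} → MGraph m → Fin m → Fin m → Set
Adj G u v = 1 ≤ G u v

data Walk {m : ℕ} (G : MGraph m) : Fin m → Fin m → Set where
  here : ∀ {u} → Walk G u u
  step : ∀ {u w v} → Adj G u w → Walk G w v → Walk G u v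

Connected : {m : ℕ} → MGraph m → Set
Connected {m} G = ∀ (u v : Fin m) → Walk G u v

Chain : {m : ℕ} → MGraph m → List (Fin m) → Set
Chain G []            = ⊤
Chain G (x ∷ [])      = ⊤
Chain G (x ∷ y ∷ r)   = Adj G x y × Chain G (y ∷ r)

HasCycle : {m : ℕ} → MGraph m → Set
HasCycle {m} G = Σ (Fin m) λ u → Σ (List (Fin m)) λ rest →
  (3 ≤ length (u ∷ rest)) × Unique (u ∷ rest) × Chain G (u ∷ rest ++ [ u ])

IsTree : {m : ℕ} → MGraph m → Set
IsTree G = IsSimpleGraph G × Connected G × ¬ HasCycle G

PathGraph : (n : ℕ) → MGraph n
PathGraph n i j =
  if (suc (toℕ i) ≡ᵇ toℕ j) ∨ (suc (toℕ j) ≡ᵇ toℕ i) then 1 else 0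

StarGraph : (n : ℕ) → MGraph n
StarGraph n i j = if (toℕ i ≡ᵇ 0) xor (toℕ j ≡ᵇ 0) then 1 else 0

Cone : {n : ℕ} → MGraph n → MGraph (suc n)
Cone T zero    zero    = 0
Cone T zero    (suc j) = 1
Cone T (suc i) zero    = 1
Cone T (suc i) (suc j) = T i j

degree : {m : ℕ} → MGraph m → Fin m → ℕ
degree {m} G v = ∑ℕ m (G v)

Laplacian : {m : ℕ} → MGraph m → Fin m → Fin m → ℤ
Laplacian G u v = if does (u ≟ v) then + degree G u else - (+ G u v)

ReducedLaplacian : {n : ℕ} → MGraph (suc n) → Fin n → Fin n → ℤ
ReducedLaplacian G i j = Laplacian G (suc i) (suc j)

InImage : {n : ℕ} → (Fin n → Fin n → ℤ) → (Fin n → ℤ) → Set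
InImage {n} M x = Σ (Fin n → ℤ) λ y → ∀ i → ∑ n (λ j → M i j ℤ.* y j) ≡ x i

-- K(G) = ℤ^{V-{v₀}} / im L̄_G is generated by (the classes of) k elements:
-- there are g₁,…,g_k ∈ ℤ^{V-{v₀}} such that every x is congruent modulo
-- im L̄_G to an integer combination of them.
SandpileGeneratedBy : {n : ℕ} → MGraph (suc n) → ℕ → Set
SandpileGeneratedBy {n} G k =
  Σ (Fin k → Fin n → ℤ) λ g →
    ∀ (x : Fin n → ℤ) → Σ (Fin k → ℤ) λ c →
      InImage (ReducedLaplacian G) (λ i → x i - ∑ k (λ t → c t ℤ.* g t i))

IsMu : {n : ℕ} → MGraph (suc n) → ℕ → Set
IsMu G k = SandpileGeneratedBy G k × (∀ k′ → k′ < k → ¬ SandpileGeneratedBy G k′)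

module Submission where

-- K(Cone G) is ℤⁿ modulo the image of I + L_G, where L_G is the Laplacian of G. Column u of
-- I + L_G is (1 + deg u) δ u − Σ_w G w u · δ w, so a unit vector δ v can be recovered from δ u
-- and the other neighbours of u. For a tree with a leaf ℓ hanging from p and another
-- neighbour q of p, all unit vectors except δ p and δ q thus generate K, giving n − 2
-- generators; for the path, δ 0 alone generates. Conversely, if G has an edge then
-- (I + L_G) y = δ v has no integral solution (by a maximum principle the solution would be
-- 0/1-valued), so K ≠ 0. For the star, reduction modulo 2 turns every leaf row of I + L_G
-- into the centre coordinate, so K / 2K needs n − 2 generators.

open import Defs

import Algebra.Properties.Semiring.Sum as SemiringSum
open import Data.Bool using (true; false; if_then_else_; _∨_)
import Data.Bool.Properties as Bool
open import Data.Empty using (⊥)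
open import Data.Fin as Fin using (Fin; zero; suc; _≟_; toℕ; fromℕ<; punchIn; punchOut)
import Data.Fin.Properties as Fin
open import Data.Integer as ℤ using (ℤ; +_; -_; -[1+_]; _+_; _*_; _-_; 0ℤ; 1ℤ; +≤+; ∣_∣; _⊖_)
import Data.Integer.Properties as ℤ
open import Data.Integer.Tactic.RingSolver using (solve-∀)
open import Data.List using (List; []; _∷_; _++_; [_]; length; lookup; allFin)
import Data.List.Properties as List
open import Data.List.Extrema ℤ.≤-totalOrder using (argmax; argmin; f[xs]≤f[argmax]; f[argmin]≤f[xs])
import Data.List.Membership.DecPropositional as DecMembership
open import Data.List.Membership.Propositional using (_∈_)
open import Data.List.Membership.Propositional.Properties using (∈-allFin; ∈-lookup; ∈-∃++)
import Data.List.Relation.Unary.All as All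
open import Data.List.Relation.Unary.All using ([]; _∷_)
import Data.List.Relation.Unary.All.Properties as Allₚ
open import Data.List.Relation.Unary.AllPairs using ([]; _∷_)
open import Data.List.Relation.Unary.Unique.Propositional using (Unique)
open import Data.Nat as ℕ using (ℕ; zero; suc; _≤_; _≥_; _∸_; _<_; z≤n; s≤s)
import Data.Nat.Properties as ℕ
open import Data.Parity.Base as ℙ using (Parity; 0ℙ; 1ℙ)
import Data.Parity.Properties as ℙ
open import Data.Product using (Σ; ∃; _×_; _,_; proj₁; proj₂)
open import Data.Sum using (_⊎_; inj₁; inj₂) renaming ([_,_] to either)
open import Function using (_∘_)
open import Relation.Binary.Definitions using (tri<; tri≈; tri>)
open import Relation.Binary.PropositionalEquality hiding ([_])
open import Relation.Nullary using (¬_; ¬?; Dec; yes; no; does; contradiction)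
open import Relation.Nullary.Decidable using (dec-true; dec-false; _×-dec_)

module ℤΣ = SemiringSum ℤ.+-*-semiring
module ℙΣ = SemiringSum ℙ.+-*-semiring

∑≡sum : ∀ m (f : Fin m → ℤ) → ∑ m f ≡ ℤΣ.sum f
∑≡sum zero    f = refl
∑≡sum (suc m) f = cong (_+_ (f zero)) (∑≡sum m (f ∘ suc))

∑-cong : ∀ m {f g : Fin m → ℤ} → f ≗ g → ∑ m f ≡ ∑ m g
∑-cong m {f} {g} f≗g = begin
  ∑ m f      ≡⟨ ∑≡sum m f ⟩
  ℤΣ.sum f   ≡⟨ ℤΣ.sum-cong-≗ f≗g ⟩
  ℤΣ.sum g   ≡⟨ ∑≡sum m g ⟨
  ∑ m g      ∎
  where open ≡-Reasoning

∑-distrib-+ : ∀ m (f g : Fin m → ℤ) → ∑ m (λ i → f i + g i) ≡ ∑ m f + ∑ m g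
∑-distrib-+ m f g = begin
  ∑ m (λ i → f i + g i)     ≡⟨ ∑≡sum m _ ⟩
  ℤΣ.sum (λ i → f i + g i)  ≡⟨ ℤΣ.∑-distrib-+ f g ⟩
  ℤΣ.sum f + ℤΣ.sum g       ≡⟨ cong₂ _+_ (∑≡sum m f) (∑≡sum m g) ⟨
  ∑ m f + ∑ m g             ∎
  where open ≡-Reasoning

∑-*ˡ : ∀ m a (f : Fin m → ℤ) → ∑ m (λ i → a * f i) ≡ a * ∑ m f
∑-*ˡ m a f = begin
  ∑ m (λ i → a * f i)     ≡⟨ ∑≡sum m _ ⟩
  ℤΣ.sum (λ i → a * f i)  ≡⟨ ℤΣ.*-distribˡ-sum a f ⟨
  a * ℤΣ.sum f            ≡⟨ cong (a *_) (∑≡sum m f) ⟨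
  a * ∑ m f               ∎
  where open ≡-Reasoning

∑-*ʳ : ∀ m a (f : Fin m → ℤ) → ∑ m (λ i → f i * a) ≡ ∑ m f * a
∑-*ʳ m a f = begin
  ∑ m (λ i → f i * a)  ≡⟨ ∑-cong m (λ i → ℤ.*-comm (f i) a) ⟩
  ∑ m (λ i → a * f i)  ≡⟨ ∑-*ˡ m a f ⟩
  a * ∑ m f            ≡⟨ ℤ.*-comm a _ ⟩
  ∑ m f * a            ∎
  where open ≡-Reasoning

∑-zero : ∀ m {f : Fin m → ℤ} → (∀ i → f i ≡ 0ℤ) → ∑ m f ≡ 0ℤ
∑-zero zero    f≡0 = refl
∑-zero (suc m) f≡0 = cong₂ _+_ (f≡0 zero) (∑-zero m (f≡0 ∘ suc))

∑-neg : ∀ m (f : Fin m → ℤ) → ∑ m (λ i → - f i) ≡ - ∑ m f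
∑-neg m f = begin
  ∑ m (λ i → - f i)      ≡⟨ ∑-cong m (λ i → ℤ.-1*i≡-i (f i)) ⟨
  ∑ m (λ i → - 1ℤ * f i) ≡⟨ ∑-*ˡ m (- 1ℤ) f ⟩
  - 1ℤ * ∑ m f           ≡⟨ ℤ.-1*i≡-i _ ⟩
  - ∑ m f                ∎
  where open ≡-Reasoning

∑-distrib-- : ∀ m (f g : Fin m → ℤ) → ∑ m (λ i → f i - g i) ≡ ∑ m f - ∑ m g
∑-distrib-- m f g = trans (∑-distrib-+ m f (λ i → - g i)) (cong (_+_ (∑ m f)) (∑-neg m g))

+∑ℕ : ∀ m (f : Fin m → ℕ) → + ∑ℕ m f ≡ ∑ m (λ i → + f i)
+∑ℕ zero    f = refl
+∑ℕ (suc m) f = trans (ℤ.pos-+ (f zero) _) (cong (_+_ (+ f zero)) (+∑ℕ m (f ∘ suc)))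

δ : ∀ {n} → Fin n → Fin n → ℤ
δ i j = if does (i ≟ j) then 1ℤ else 0ℤ

δ-refl : ∀ {n} (i : Fin n) → δ i i ≡ 1ℤ
δ-refl zero    = refl
δ-refl (suc i) = δ-refl i

δ-≢ : ∀ {n} {i j : Fin n} → i ≢ j → δ i j ≡ 0ℤ
δ-≢ {i = zero}  {zero}  i≢j = contradiction refl i≢j
δ-≢ {i = zero}  {suc j} i≢j = refl
δ-≢ {i = suc i} {zero}  i≢j = refl
δ-≢ {i = suc i} {suc j} i≢j = δ-≢ (i≢j ∘ cong suc)

δ-sym : ∀ {n} (i j : Fin n) → δ i j ≡ δ j i
δ-sym zero    zero    = refl
δ-sym zero    (suc j) = refl
δ-sym (suc i) zero    = refl
δ-sym (suc i) (suc j) = δ-sym i j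

∑-δˡ : ∀ m (f : Fin m → ℤ) j → ∑ m (λ i → δ i j * f i) ≡ f j
∑-δˡ (suc m) f zero = begin
  1ℤ * f zero + ∑ m (λ i → 0ℤ * f (suc i))  ≡⟨ cong₂ _+_ (ℤ.*-identityˡ (f zero)) (∑-zero m (λ i → ℤ.*-zeroˡ (f (suc i)))) ⟩
  f zero + 0ℤ                               ≡⟨ ℤ.+-identityʳ _ ⟩
  f zero                                    ∎
  where open ≡-Reasoning
∑-δˡ (suc m) f (suc j) = begin
  0ℤ * f zero + ∑ m (λ i → δ i j * f (suc i))  ≡⟨ cong (_+ ∑ m (λ i → δ i j * f (suc i))) (ℤ.*-zeroˡ (f zero)) ⟩
  0ℤ + ∑ m (λ i → δ i j * f (suc i))           ≡⟨ ℤ.+-identityˡ _ ⟩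
  ∑ m (λ i → δ i j * f (suc i))                ≡⟨ ∑-δˡ m (f ∘ suc) j ⟩
  f (suc j)                                    ∎
  where open ≡-Reasoning

∑-δʳ : ∀ m (f : Fin m → ℤ) j → ∑ m (λ i → f i * δ i j) ≡ f j
∑-δʳ m f j = trans (∑-cong m (λ i → ℤ.*-comm (f i) (δ i j))) (∑-δˡ m f j)

0≤δ : ∀ {n} (i j : Fin n) → 0ℤ ℤ.≤ δ i j
0≤δ i j with does (i ≟ j)
... | true  = +≤+ z≤n
... | false = +≤+ z≤n

δ≤1 : ∀ {n} (i j : Fin n) → δ i j ℤ.≤ 1ℤ
δ≤1 i j with does (i ≟ j)
... | true  = +≤+ (s≤s z≤n)
... | false = +≤+ z≤n

-- Generation modulo the image of a matrix

module Generation {n : ℕ} (M : Fin n → Fin n → ℤ) {k : ℕ} (g : Fin k → Fin n → ℤ) where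

  combination : (Fin k → ℤ) → Fin n → ℤ
  combination c i = ∑ k (λ t → c t * g t i)

  Generated : (Fin n → ℤ) → Set
  Generated x = Σ (Fin k → ℤ) λ c → InImage M (λ i → x i - combination c i)

  generated-resp : ∀ {x x′} → x ≗ x′ → Generated x → Generated x′
  generated-resp x≗x′ (c , y , My≡) = c , y , λ i → trans (My≡ i) (cong (_- combination c i) (x≗x′ i))

  generated-0 : Generated (λ _ → 0ℤ)
  generated-0 = (λ _ → 0ℤ) , (λ _ → 0ℤ) , λ i →
    trans (∑-zero n (λ j → ℤ.*-zeroʳ (M i j)))
          (sym (cong (λ s → 0ℤ - s) (∑-zero k (λ t → ℤ.*-zeroˡ (g t i)))))

  generated-+ : ∀ {x x′} → Generated x → Generated x′ → Generated (λ i → x i + x′ i)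
  generated-+ {x} {x′} (c , y , My≡) (c′ , y′ , My′≡) =
    (λ t → c t + c′ t) , (λ j → y j + y′ j) , λ i → begin
      ∑ n (λ j → M i j * (y j + y′ j))
        ≡⟨ ∑-cong n (λ j → ℤ.*-distribˡ-+ (M i j) (y j) (y′ j)) ⟩
      ∑ n (λ j → M i j * y j + M i j * y′ j)
        ≡⟨ ∑-distrib-+ n _ _ ⟩
      ∑ n (λ j → M i j * y j) + ∑ n (λ j → M i j * y′ j)
        ≡⟨ cong₂ _+_ (My≡ i) (My′≡ i) ⟩
      (x i - combination c i) + (x′ i - combination c′ i)
        ≡⟨ regroup (x i) (x′ i) _ _ ⟩
      (x i + x′ i) - (combination c i + combination c′ i)
        ≡⟨ cong (_-_ (x i + x′ i)) (∑-distrib-+ k _ _) ⟨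
      (x i + x′ i) - ∑ k (λ t → c t * g t i + c′ t * g t i)
        ≡⟨ cong (_-_ (x i + x′ i)) (∑-cong k (λ t → ℤ.*-distribʳ-+ (g t i) (c t) (c′ t))) ⟨
      (x i + x′ i) - combination (λ t → c t + c′ t) i ∎
    where
    open ≡-Reasoning
    regroup : ∀ a b c d → (a - c) + (b - d) ≡ (a + b) - (c + d)
    regroup = solve-∀

  generated-* : ∀ {x} a → Generated x → Generated (λ i → a * x i)
  generated-* {x} a (c , y , My≡) = (λ t → a * c t) , (λ j → a * y j) , λ i → begin
      ∑ n (λ j → M i j * (a * y j))
        ≡⟨ ∑-cong n (λ j → *-swap (M i j) a (y j)) ⟩
      ∑ n (λ j → a * (M i j * y j))
        ≡⟨ ∑-*ˡ n a _ ⟩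
      a * ∑ n (λ j → M i j * y j)
        ≡⟨ cong (a *_) (My≡ i) ⟩
      a * (x i - combination c i)
        ≡⟨ *-distribˡ-- a (x i) _ ⟩
      a * x i - a * combination c i
        ≡⟨ cong (_-_ (a * x i)) (∑-*ˡ k a _) ⟨
      a * x i - ∑ k (λ t → a * (c t * g t i))
        ≡⟨ cong (_-_ (a * x i)) (∑-cong k (λ t → ℤ.*-assoc a (c t) (g t i))) ⟨
      a * x i - combination (λ t → a * c t) i ∎
    where
    open ≡-Reasoning
    *-swap : ∀ m a y → m * (a * y) ≡ a * (m * y)
    *-swap = solve-∀
    *-distribˡ-- : ∀ a x s → a * (x - s) ≡ a * x - a * s
    *-distribˡ-- = solve-∀

  generated-column : ∀ j → Generated (λ i → M i j)
  generated-column j = (λ _ → 0ℤ) , (λ l → δ l j) , λ i → begin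
      ∑ n (λ l → M i l * δ l j)    ≡⟨ ∑-δʳ n (M i) j ⟩
      M i j                        ≡⟨ ℤ.+-identityʳ (M i j) ⟨
      M i j - 0ℤ                   ≡⟨ cong (_-_ (M i j)) (∑-zero k (λ t → ℤ.*-zeroˡ (g t i))) ⟨
      M i j - combination (λ _ → 0ℤ) i ∎
    where open ≡-Reasoning

  generated-generator : ∀ t → Generated (g t)
  generated-generator t = (λ s → δ s t) , (λ _ → 0ℤ) , λ i → begin
      ∑ n (λ j → M i j * 0ℤ)         ≡⟨ ∑-zero n (λ j → ℤ.*-zeroʳ (M i j)) ⟩
      0ℤ                             ≡⟨ ℤ.+-inverseʳ (g t i) ⟨
      g t i - g t i                  ≡⟨ cong (_-_ (g t i)) (∑-δˡ k (λ s → g s i) t) ⟨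
      g t i - combination (λ s → δ s t) i ∎
    where open ≡-Reasoning

  generated-∑ : ∀ m (x : Fin m → Fin n → ℤ) → (∀ r → Generated (x r)) →
                Generated (λ i → ∑ m (λ r → x r i))
  generated-∑ zero    x gen = generated-0
  generated-∑ (suc m) x gen =
    generated-+ {x zero} {λ i → ∑ m (λ r → x (suc r) i)} (gen zero) (generated-∑ m (x ∘ suc) (gen ∘ suc))

  generated-from-units : ∀ x → (∀ i → x i ≡ 0ℤ ⊎ Generated (δ i)) → Generated x
  generated-from-units x units =
    generated-resp (∑-δʳ n x) (generated-∑ n (λ i j → x i * δ i j) scaled-unit)
    where
    scaled-unit : ∀ i → Generated (λ j → x i * δ i j)
    scaled-unit i with units i
    ... | inj₂ δᵢ-generated = generated-* (x i) δᵢ-generated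
    ... | inj₁ xᵢ≡0 =
      generated-resp (λ j → sym (trans (cong (_* δ i j) xᵢ≡0) (ℤ.*-zeroˡ (δ i j)))) generated-0

module _ {n : ℕ} (G : MGraph n) where

  Adj-sym : (∀ u v → G u v ≡ G v u) → ∀ {u v} → Adj G u v → Adj G v u
  Adj-sym symmetric {u} {v} = subst (1 ≤_) (symmetric u v)

  Adj-irrefl : (∀ u → G u u ≡ 0) → ∀ {u v} → Adj G u v → u ≢ v
  Adj-irrefl loopless {u} u~u refl = contradiction (subst (1 ≤_) (loopless u) u~u) λ ()

  Chain-close : ∀ xs {w ys z} → Chain G (xs ++ w ∷ ys) → Adj G w z → Chain G ((xs ++ [ w ]) ++ [ z ])
  Chain-close []            _            w~z = w~z , _
  Chain-close (x ∷ [])      (x~w , _)    w~z = x~w , w~z , _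
  Chain-close (x ∷ x′ ∷ xs) (x~x′ , c)   w~z = x~x′ , Chain-close (x′ ∷ xs) c w~z

  Walk-closed : (P : Fin n → Set) → (∀ {x y} → P x → Adj G x y → P y) →
                ∀ {x y} → Walk G x y → P x → P y
  Walk-closed P closed here         Px = Px
  Walk-closed P closed (step x~z w) Px = Walk-closed P closed w (closed Px x~z)

  Pendant : Fin n → Fin n → Set
  Pendant ℓ p = Adj G ℓ p × (∀ w → Adj G ℓ w → w ≡ p)

-- The reduced Laplacian of a cone

Δ : ∀ {n} → MGraph n → (Fin n → ℤ) → Fin n → ℤ
Δ {n} G y i = ∑ n (λ l → + G i l * (y i - y l))

module _ {n : ℕ} (G : MGraph n) where

  coneLaplacian-≢ : ∀ {i j} → i ≢ j → ReducedLaplacian (Cone G) i j ≡ - + G i j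
  coneLaplacian-≢ {i} {j} i≢j =
    cong (if_then + suc (degree G i) else - + G i j) (dec-false (i ≟ j) i≢j)

  coneLaplacian-diag : ∀ i → ReducedLaplacian (Cone G) i i ≡ + suc (degree G i)
  coneLaplacian-diag i = cong (if_then + suc (degree G i) else - + G i i) (dec-true (i ≟ i) refl)

  coneLaplacian : (∀ u → G u u ≡ 0) →
                  ∀ i j → ReducedLaplacian (Cone G) i j ≡ δ i j * + suc (degree G i) - + G i j
  coneLaplacian loopless i j = entry (i ≟ j)
    where
    D = + suc (degree G i)
    entry : Dec (i ≡ j) → ReducedLaplacian (Cone G) i j ≡ δ i j * D - + G i j
    entry (yes refl) = begin
      ReducedLaplacian (Cone G) i i           ≡⟨ coneLaplacian-diag i ⟩
      D                                       ≡⟨ ℤ.*-identityˡ D ⟨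
      1ℤ * D                                  ≡⟨ ℤ.+-identityʳ _ ⟨
      1ℤ * D - 0ℤ                             ≡⟨ cong₂ (λ a b → a * D - + b) (δ-refl i) (loopless i) ⟨
      δ i i * D - + G i i                     ∎
      where open ≡-Reasoning
    entry (no i≢j) = begin
      ReducedLaplacian (Cone G) i j           ≡⟨ coneLaplacian-≢ i≢j ⟩
      - + G i j                               ≡⟨ ℤ.+-identityˡ _ ⟨
      0ℤ - + G i j                            ≡⟨ cong (λ a → a - + G i j) (ℤ.*-zeroˡ D) ⟨
      0ℤ * D - + G i j                        ≡⟨ cong (λ a → a * D - + G i j) (δ-≢ i≢j) ⟨
      δ i j * D - + G i j                     ∎
      where open ≡-Reasoning

  coneLaplacian-apply : (∀ u → G u u ≡ 0) → ∀ (y : Fin n → ℤ) i →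
    ∑ n (λ l → ReducedLaplacian (Cone G) i l * y l) ≡ y i + Δ G y i
  coneLaplacian-apply loopless y i = begin
    ∑ n (λ l → ReducedLaplacian (Cone G) i l * y l)
      ≡⟨ ∑-cong n (λ l → cong (_* y l) (coneLaplacian loopless i l)) ⟩
    ∑ n (λ l → (δ i l * D - + G i l) * y l)
      ≡⟨ ∑-cong n (λ l → trans (split (δ i l) D (+ G i l) (y l))
                                (cong (λ d → d * (D * y l) - + G i l * y l) (δ-sym i l))) ⟩
    ∑ n (λ l → δ l i * (D * y l) - + G i l * y l)
      ≡⟨ ∑-distrib-- n _ _ ⟩
    ∑ n (λ l → δ l i * (D * y l)) - ∑ n (λ l → + G i l * y l)
      ≡⟨ cong (_- ∑ n (λ l → + G i l * y l)) (∑-δˡ n (λ l → D * y l) i) ⟩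
    D * y i - ∑ n (λ l → + G i l * y l)
      ≡⟨ cong (λ d → (+ 1 + d) * y i - ∑ n (λ l → + G i l * y l)) (+∑ℕ n (G i)) ⟩
    (1ℤ + ∑ n (λ l → + G i l)) * y i - ∑ n (λ l → + G i l * y l)
      ≡⟨ regroup (y i) (∑ n (λ l → + G i l)) _ ⟩
    y i + (∑ n (λ l → + G i l) * y i - ∑ n (λ l → + G i l * y l))
      ≡⟨ cong (λ s → y i + (s - ∑ n (λ l → + G i l * y l))) (∑-*ʳ n (y i) _) ⟨
    y i + (∑ n (λ l → + G i l * y i) - ∑ n (λ l → + G i l * y l))
      ≡⟨ cong (_+_ (y i)) (∑-distrib-- n _ _) ⟨
    y i + ∑ n (λ l → + G i l * y i - + G i l * y l)
      ≡⟨ cong (_+_ (y i)) (∑-cong n (λ l → factor (+ G i l) (y i) (y l))) ⟩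
    y i + ∑ n (λ l → + G i l * (y i - y l)) ∎
    where
    open ≡-Reasoning
    D = + suc (degree G i)
    split : ∀ d D a y → (d * D - a) * y ≡ d * (D * y) - a * y
    split = solve-∀
    regroup : ∀ y s t → (1ℤ + s) * y - t ≡ y + (s * y - t)
    regroup = solve-∀
    factor : ∀ a y z → a * y - a * z ≡ a * (y - z)
    factor = solve-∀

module _ {n : ℕ} (G : MGraph n) {k : ℕ} (g : Fin k → Fin n → ℤ) where
  open Generation (ReducedLaplacian (Cone G)) g

  -- δ v plus the column of u vanishes at v and is supported on u and its other neighbours.
  generated-last-neighbour : ∀ {u v} → u ≢ v → G v u ≡ 1 → Generated (δ u) →
    (∀ w → w ≢ v → w ≢ u → G w u ≡ 0 ⊎ Generated (δ w)) → Generated (δ v)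
  generated-last-neighbour {u} {v} u≢v Gvu≡1 δu-gen others =
    generated-resp (λ i → cancel (δ v i) (M i u))
      (generated-+ {x = z} (generated-from-units z z-units)
                           (generated-* {λ i → M i u} (- 1ℤ) (generated-column u)))
    where
    M = ReducedLaplacian (Cone G)
    z : Fin n → ℤ
    z i = δ v i + M i u
    cancel : ∀ a b → a + b + - 1ℤ * b ≡ a
    cancel = solve-∀
    z-unit : ∀ i → Dec (i ≡ v) → Dec (i ≡ u) → z i ≡ 0ℤ ⊎ Generated (δ i)
    z-unit i (yes refl) _ = inj₁ (begin
      δ v v + M v u     ≡⟨ cong₂ _+_ (δ-refl v) (coneLaplacian-≢ G (u≢v ∘ sym)) ⟩
      1ℤ - + G v u      ≡⟨ cong (λ a → 1ℤ - + a) Gvu≡1 ⟩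
      0ℤ                ∎)
      where open ≡-Reasoning
    z-unit i (no _) (yes refl) = inj₂ δu-gen
    z-unit i (no i≢v) (no i≢u) with others i i≢v i≢u
    ... | inj₂ δi-gen = inj₂ δi-gen
    ... | inj₁ Giu≡0  = inj₁ (begin
      δ v i + M i u     ≡⟨ cong₂ _+_ (δ-≢ (i≢v ∘ sym)) (coneLaplacian-≢ G i≢u) ⟩
      0ℤ - + G i u      ≡⟨ cong (λ a → 0ℤ - + a) Giu≡0 ⟩
      0ℤ                ∎)
      where open ≡-Reasoning
    z-units : ∀ i → z i ≡ 0ℤ ⊎ Generated (δ i)
    z-units i = z-unit i (i ≟ v) (i ≟ u)

-- Upper bounds

skip₂ : ∀ {m} {i j : Fin (suc (suc m))} → i ≢ j → Fin m → Fin (suc (suc m))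
skip₂ {i = i} i≢j t = punchIn i (punchIn (punchOut i≢j) t)

skip₂-≢ˡ : ∀ {m} {i j : Fin (suc (suc m))} (i≢j : i ≢ j) t → skip₂ i≢j t ≢ i
skip₂-≢ˡ {i = i} i≢j t = Fin.punchInᵢ≢i i _

skip₂-≢ʳ : ∀ {m} {i j : Fin (suc (suc m))} (i≢j : i ≢ j) t → skip₂ i≢j t ≢ j
skip₂-≢ʳ {i = i} i≢j t eq = Fin.punchInᵢ≢i (punchOut i≢j) t
  (Fin.punchIn-injective i _ _ (trans eq (sym (Fin.punchIn-punchOut i≢j))))

skip₂-onto : ∀ {m} {i j v : Fin (suc (suc m))} (i≢j : i ≢ j) → v ≢ i → v ≢ j →
             ∃ λ t → skip₂ i≢j t ≡ v
skip₂-onto {i = i} {j} {v} i≢j v≢i v≢j = punchOut j′≢v′ , (begin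
  punchIn i (punchIn (punchOut i≢j) (punchOut j′≢v′))  ≡⟨ cong (punchIn i) (Fin.punchIn-punchOut j′≢v′) ⟩
  punchIn i (punchOut i≢v)                             ≡⟨ Fin.punchIn-punchOut i≢v ⟩
  v                                                    ∎)
  where
  open ≡-Reasoning
  i≢v : i ≢ v
  i≢v = v≢i ∘ sym
  j′≢v′ : punchOut i≢j ≢ punchOut i≢v
  j′≢v′ eq = v≢j (sym (Fin.punchOut-injective i≢j i≢v eq))

-- The generators are δ v for v ∉ {p, q}; δ p and δ q are recovered from the columns of ℓ and p.
pendant-generatedBy : ∀ {m} (G : MGraph (suc (suc m))) {ℓ p q} →
  ℓ ≢ p → ℓ ≢ q → p ≢ q → G p ℓ ≡ 1 → (∀ w → w ≢ p → w ≢ ℓ → G w ℓ ≡ 0) → G q p ≡ 1 →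
  SandpileGeneratedBy (Cone G) m
pendant-generatedBy {m} G {ℓ} {p} {q} ℓ≢p ℓ≢q p≢q Gpℓ≡1 ℓ-pendant Gqp≡1 =
  generators , λ x → generated-from-units x (inj₂ ∘ unit)
  where
  generators : Fin m → Fin (suc (suc m)) → ℤ
  generators t = δ (skip₂ p≢q t)
  open Generation (ReducedLaplacian (Cone G)) generators
  unit-≢ : ∀ v → v ≢ p → v ≢ q → Generated (δ v)
  unit-≢ v v≢p v≢q with skip₂-onto p≢q v≢p v≢q
  ... | t , refl = generated-generator t
  unit-p : Generated (δ p)
  unit-p = generated-last-neighbour G generators ℓ≢p Gpℓ≡1 (unit-≢ ℓ ℓ≢p ℓ≢q)
             (λ w w≢p w≢ℓ → inj₁ (ℓ-pendant w w≢p w≢ℓ))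
  unit-q : Generated (δ q)
  unit-q = generated-last-neighbour G generators p≢q Gqp≡1 unit-p
             (λ w w≢q w≢p → inj₂ (unit-≢ w w≢p w≢q))
  unit-dec : ∀ v → Dec (v ≡ p) → Dec (v ≡ q) → Generated (δ v)
  unit-dec v (yes refl) _          = unit-p
  unit-dec v (no _)     (yes refl) = unit-q
  unit-dec v (no v≢p)   (no v≢q)   = unit-≢ v v≢p v≢q
  unit : ∀ v → Generated (δ v)
  unit v = unit-dec v (v ≟ p) (v ≟ q)

-- does (m ℕ.≟ n) is definitionally m ℕ.≡ᵇ n, the test used in PathGraph.
pathGraph-adjacent : ∀ {N} (i j : Fin N) → toℕ i ≡ suc (toℕ j) → PathGraph N i j ≡ 1
pathGraph-adjacent i j i≡1+j =
  cong (if_then 1 else 0)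
    (trans (cong ((suc (toℕ i) ℕ.≡ᵇ toℕ j) ∨_) (dec-true (suc (toℕ j) ℕ.≟ toℕ i) (sym i≡1+j)))
           (Bool.∨-zeroʳ (suc (toℕ i) ℕ.≡ᵇ toℕ j)))

pathGraph-nonadjacent : ∀ {N} (i j : Fin N) → suc (toℕ i) ≢ toℕ j → suc (toℕ j) ≢ toℕ i →
                        PathGraph N i j ≡ 0
pathGraph-nonadjacent i j i≉j j≉i =
  cong (if_then 1 else 0) (cong₂ _∨_ (dec-false (suc (toℕ i) ℕ.≟ toℕ j) i≉j)
                                     (dec-false (suc (toℕ j) ℕ.≟ toℕ i) j≉i))

pathGraph-loopless : ∀ {N} (i : Fin N) → PathGraph N i i ≡ 0
pathGraph-loopless i = pathGraph-nonadjacent i i ℕ.1+n≢n ℕ.1+n≢n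

-- δ 0 generates, and δ (K + 1) is recovered from the column of K.
path-generatedBy-1 : ∀ m → SandpileGeneratedBy (Cone (PathGraph (suc m))) 1
path-generatedBy-1 m = generator , λ x → generated-from-units x (λ i → inj₂ (prefix (toℕ i) i ℕ.≤-refl))
  where
  N = suc m
  generator : Fin 1 → Fin N → ℤ
  generator _ = δ zero
  open Generation (ReducedLaplacian (Cone (PathGraph N))) generator
  prefix : ∀ K i → toℕ i ≤ K → Generated (δ i)
  prefix zero    zero    _ = generated-generator zero
  prefix (suc K) i i≤1+K with toℕ i ℕ.≤? K
  ... | yes i≤K = prefix K i i≤K
  ... | no  i≰K = generated-last-neighbour (PathGraph N) generator u≢i
                    (pathGraph-adjacent i u (trans i≡1+K (cong suc (sym u≡K))))
                    (prefix K u (ℕ.≤-reflexive u≡K)) others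
    where
    i≡1+K : toℕ i ≡ suc K
    i≡1+K = ℕ.≤-antisym i≤1+K (ℕ.≰⇒> i≰K)
    K<N : K < N
    K<N = ℕ.<-trans (ℕ.≤-reflexive (sym i≡1+K)) (Fin.toℕ<n i)
    u : Fin N
    u = fromℕ< K<N
    u≡K : toℕ u ≡ K
    u≡K = Fin.toℕ-fromℕ< K<N
    u≢i : u ≢ i
    u≢i u≡i = ℕ.1+n≢n (trans (sym i≡1+K) (trans (cong toℕ (sym u≡i)) u≡K))
    others : ∀ w → w ≢ i → w ≢ u → PathGraph N w u ≡ 0 ⊎ Generated (δ w)
    others w w≢i w≢u with toℕ w ℕ.≤? K
    ... | yes w≤K = inj₂ (prefix K w w≤K)
    ... | no  w≰K = inj₁ (pathGraph-nonadjacent w u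
            (λ 1+w≡u → w≰K (ℕ.<⇒≤ (subst (toℕ w <_) u≡K (ℕ.≤-reflexive 1+w≡u))))
            (λ 1+u≡w → w≢i (Fin.toℕ-injective (trans (sym 1+u≡w) (trans (cong suc u≡K) (sym i≡1+K))))))

-- A maximum principle

∑-nonneg : ∀ m {f : Fin m → ℤ} → (∀ i → 0ℤ ℤ.≤ f i) → 0ℤ ℤ.≤ ∑ m f
∑-nonneg zero    f≥0 = ℤ.≤-refl
∑-nonneg (suc m) f≥0 = ℤ.+-mono-≤ (f≥0 zero) (∑-nonneg m (f≥0 ∘ suc))

∑-nonpos : ∀ m {f : Fin m → ℤ} → (∀ i → f i ℤ.≤ 0ℤ) → ∑ m f ℤ.≤ 0ℤ
∑-nonpos zero    f≤0 = ℤ.≤-refl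
∑-nonpos (suc m) f≤0 = ℤ.+-mono-≤ (f≤0 zero) (∑-nonpos m (f≤0 ∘ suc))

term≤∑ : ∀ m {f : Fin m → ℤ} → (∀ i → 0ℤ ℤ.≤ f i) → ∀ j → f j ℤ.≤ ∑ m f
term≤∑ (suc m) {f} f≥0 zero = begin
  f zero                   ≡⟨ ℤ.+-identityʳ (f zero) ⟨
  f zero + 0ℤ              ≤⟨ ℤ.+-monoʳ-≤ (f zero) (∑-nonneg m (f≥0 ∘ suc)) ⟩
  f zero + ∑ m (f ∘ suc)   ∎
  where open ℤ.≤-Reasoning
term≤∑ (suc m) {f} f≥0 (suc j) = begin
  f (suc j)                ≤⟨ term≤∑ m (f≥0 ∘ suc) j ⟩
  ∑ m (f ∘ suc)            ≡⟨ ℤ.+-identityˡ _ ⟨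
  0ℤ + ∑ m (f ∘ suc)       ≤⟨ ℤ.+-monoˡ-≤ (∑ m (f ∘ suc)) (f≥0 zero) ⟩
  f zero + ∑ m (f ∘ suc)   ∎
  where open ℤ.≤-Reasoning

+*-nonneg : ∀ a {d} → 0ℤ ℤ.≤ d → 0ℤ ℤ.≤ + a * d
+*-nonneg a {d} 0≤d = subst (ℤ._≤ + a * d) (ℤ.*-zeroʳ (+ a)) (ℤ.*-monoˡ-≤-nonNeg (+ a) 0≤d)

+*-nonpos : ∀ a {d} → d ℤ.≤ 0ℤ → + a * d ℤ.≤ 0ℤ
+*-nonpos a {d} d≤0 = subst (+ a * d ℤ.≤_) (ℤ.*-zeroʳ (+ a)) (ℤ.*-monoˡ-≤-nonNeg (+ a) d≤0)

0≤i≤1⇒i≡0⊎i≡1 : ∀ {i} → 0ℤ ℤ.≤ i → i ℤ.≤ 1ℤ → i ≡ 0ℤ ⊎ i ≡ 1ℤ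
0≤i≤1⇒i≡0⊎i≡1 {+ 0}           _ _                   = inj₁ refl
0≤i≤1⇒i≡0⊎i≡1 {+ 1}           _ _                   = inj₂ refl
0≤i≤1⇒i≡0⊎i≡1 {+ suc (suc _)} _ (+≤+ (s≤s ()))

∃-argmax : ∀ {n} (y : Fin n → ℤ) → Fin n → ∃ λ j → ∀ i → y i ℤ.≤ y j
∃-argmax {n} y v = argmax y v (allFin n) , λ i → All.lookup (f[xs]≤f[argmax] {f = y} v (allFin n)) (∈-allFin i)

∃-argmin : ∀ {n} (y : Fin n → ℤ) → Fin n → ∃ λ j → ∀ i → y j ℤ.≤ y i
∃-argmin {n} y v = argmin y v (allFin n) , λ i → All.lookup (f[argmin]≤f[xs] {f = y} v (allFin n)) (∈-allFin i)

module _ {n : ℕ} (G : MGraph n) where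

  Δ-nonneg-at-max : ∀ y {i} → (∀ l → y l ℤ.≤ y i) → 0ℤ ℤ.≤ Δ G y i
  Δ-nonneg-at-max y {i} y≤yᵢ = ∑-nonneg n (λ l → +*-nonneg (G i l) (ℤ.i≤j⇒0≤j-i (y≤yᵢ l)))

  Δ-nonpos-at-min : ∀ y {i} → (∀ l → y i ℤ.≤ y l) → Δ G y i ℤ.≤ 0ℤ
  Δ-nonpos-at-min y {i} yᵢ≤y = ∑-nonpos n (λ l → +*-nonpos (G i l) (ℤ.i≤j⇒i-j≤0 (yᵢ≤y l)))

  edge≤Δ-at-max : ∀ y {i} → (∀ l → y l ℤ.≤ y i) → ∀ j → + G i j * (y i - y j) ℤ.≤ Δ G y i
  edge≤Δ-at-max y {i} y≤yᵢ = term≤∑ n (λ l → +*-nonneg (G i l) (ℤ.i≤j⇒0≤j-i (y≤yᵢ l)))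

  IsSolution : Fin n → (Fin n → ℤ) → Set
  IsSolution v y = ∀ i → y i + Δ G y i ≡ δ v i

  solution≤1 : ∀ {v y} → IsSolution v y → ∀ l → y l ℤ.≤ 1ℤ
  solution≤1 {v} {y} solves l with ∃-argmax y v
  ... | j , y≤yⱼ = begin
    y l            ≤⟨ y≤yⱼ l ⟩
    y j            ≡⟨ ℤ.+-identityʳ (y j) ⟨
    y j + 0ℤ       ≤⟨ ℤ.+-monoʳ-≤ (y j) (Δ-nonneg-at-max y y≤yⱼ) ⟩
    y j + Δ G y j  ≡⟨ solves j ⟩
    δ v j          ≤⟨ δ≤1 v j ⟩
    1ℤ             ∎
    where open ℤ.≤-Reasoning

  solution≥0 : ∀ {v y} → IsSolution v y → ∀ l → 0ℤ ℤ.≤ y l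
  solution≥0 {v} {y} solves l with ∃-argmin y v
  ... | j , yⱼ≤y = begin
    0ℤ             ≤⟨ 0≤δ v j ⟩
    δ v j          ≡⟨ solves j ⟨
    y j + Δ G y j  ≤⟨ ℤ.+-monoʳ-≤ (y j) (Δ-nonpos-at-min y yⱼ≤y) ⟩
    y j + 0ℤ       ≡⟨ ℤ.+-identityʳ (y j) ⟩
    y j            ≤⟨ yⱼ≤y l ⟩
    y l            ∎
    where open ℤ.≤-Reasoning

  -- A solution takes values in {0, 1}. Then y v = 1 forces Δ G y v = 0, whereas the
  -- neighbour w has y w = 0 and so contributes G v w ≥ 1 to Δ G y v.
  no-integral-solution : ∀ {v w y} → v ≢ w → Adj G v w → ¬ IsSolution v y
  no-integral-solution {v} {w} {y} v≢w v~w solves = cases (binary v) (binary w)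
    where
    open ℤ.≤-Reasoning
    binary : ∀ l → y l ≡ 0ℤ ⊎ y l ≡ 1ℤ
    binary l = 0≤i≤1⇒i≡0⊎i≡1 (solution≥0 {v} {y} solves l) (solution≤1 {v} {y} solves l)
    max-at : ∀ {i} → y i ≡ 1ℤ → ∀ l → y l ℤ.≤ y i
    max-at yᵢ≡1 l = subst (y l ℤ.≤_) (sym yᵢ≡1) (solution≤1 {v} {y} solves l)
    min-at : ∀ {i} → y i ≡ 0ℤ → ∀ l → y i ℤ.≤ y l
    min-at yᵢ≡0 l = subst (ℤ._≤ y l) (sym yᵢ≡0) (solution≥0 {v} {y} solves l)
    add-sub : ∀ a b → a + b - a ≡ b
    add-sub = solve-∀
    1≰0 : ¬ 1ℤ ℤ.≤ 0ℤ
    1≰0 (+≤+ ())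
    cases : y v ≡ 0ℤ ⊎ y v ≡ 1ℤ → y w ≡ 0ℤ ⊎ y w ≡ 1ℤ → ⊥
    cases (inj₁ yᵥ≡0) _ = 1≰0 (begin
      1ℤ             ≡⟨ trans (sym (δ-refl v)) (sym (solves v)) ⟩
      y v + Δ G y v  ≤⟨ ℤ.+-monoʳ-≤ (y v) (Δ-nonpos-at-min y (min-at yᵥ≡0)) ⟩
      y v + 0ℤ       ≡⟨ trans (ℤ.+-identityʳ (y v)) yᵥ≡0 ⟩
      0ℤ             ∎)
    cases (inj₂ yᵥ≡1) (inj₂ y_w≡1) = 1≰0 (begin
      1ℤ             ≡⟨ ℤ.+-identityʳ 1ℤ ⟨
      1ℤ + 0ℤ        ≤⟨ ℤ.+-monoʳ-≤ 1ℤ (Δ-nonneg-at-max y (max-at y_w≡1)) ⟩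
      1ℤ + Δ G y w   ≡⟨ cong (_+ Δ G y w) (sym y_w≡1) ⟩
      y w + Δ G y w  ≡⟨ trans (solves w) (δ-≢ v≢w) ⟩
      0ℤ             ∎)
    cases (inj₂ yᵥ≡1) (inj₁ y_w≡0) = 1≰0 (begin
      1ℤ                     ≤⟨ +≤+ v~w ⟩
      + G v w                ≡⟨ ℤ.*-identityʳ (+ G v w) ⟨
      + G v w * (1ℤ - 0ℤ)    ≡⟨ cong₂ (λ a b → + G v w * (a - b)) yᵥ≡1 y_w≡0 ⟨
      + G v w * (y v - y w)  ≤⟨ edge≤Δ-at-max y (max-at yᵥ≡1) w ⟩
      Δ G y v                ≡⟨ add-sub 1ℤ (Δ G y v) ⟨
      1ℤ + Δ G y v - 1ℤ      ≡⟨ cong (λ a → a + Δ G y v - 1ℤ) yᵥ≡1 ⟨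
      y v + Δ G y v - 1ℤ     ≡⟨ cong (_- 1ℤ) (trans (solves v) (δ-refl v)) ⟩
      0ℤ                     ∎)

cone-not-generatedBy-0 : ∀ {n} (G : MGraph n) → (∀ u → G u u ≡ 0) → ∀ {v w} → Adj G v w →
                         ¬ SandpileGeneratedBy (Cone G) 0
cone-not-generatedBy-0 {n} G loopless {v} {w} v~w (_ , generated) with generated (δ v)
... | _ , y , My≡δv = no-integral-solution G {y = y} (Adj-irrefl G loopless v~w) v~w λ i → begin
  y i + Δ G y i                                    ≡⟨ coneLaplacian-apply G loopless y i ⟨
  ∑ n (λ l → ReducedLaplacian (Cone G) i l * y l)  ≡⟨ My≡δv i ⟩
  δ v i + 0ℤ                                       ≡⟨ ℤ.+-identityʳ (δ v i) ⟩
  δ v i                                            ∎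
  where open ≡-Reasoning

-- Parity and spanning families over ℤ/2

parityℤ : ℤ → Parity
parityℤ i = ℕ.parity ∣ i ∣

parity-suc+suc : ∀ m n → ℕ.parity (suc m) ℙ.+ ℕ.parity (suc n) ≡ ℕ.parity m ℙ.+ ℕ.parity n
parity-suc+suc m n = begin
  ℕ.parity (suc m) ℙ.+ ℕ.parity (suc n)  ≡⟨ ℙ.+-homo-+ (suc m) (suc n) ⟨
  ℕ.parity (suc m ℕ.+ suc n)             ≡⟨ cong (ℕ.parity ∘ suc) (ℕ.+-suc m n) ⟩
  ℕ.parity (m ℕ.+ n)                     ≡⟨ ℙ.+-homo-+ m n ⟩
  ℕ.parity m ℙ.+ ℕ.parity n              ∎
  where open ≡-Reasoning

parityℤ-⊖ : ∀ m n → parityℤ (m ⊖ n) ≡ ℕ.parity m ℙ.+ ℕ.parity n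
parityℤ-⊖ zero    zero    = refl
parityℤ-⊖ zero    (suc n) = refl
parityℤ-⊖ (suc m) zero    = sym (ℙ.+-identityʳ _)
parityℤ-⊖ (suc m) (suc n) = begin
  parityℤ (suc m ⊖ suc n)                ≡⟨ cong parityℤ (ℤ.[1+m]⊖[1+n]≡m⊖n m n) ⟩
  parityℤ (m ⊖ n)                        ≡⟨ parityℤ-⊖ m n ⟩
  ℕ.parity m ℙ.+ ℕ.parity n              ≡⟨ parity-suc+suc m n ⟨
  ℕ.parity (suc m) ℙ.+ ℕ.parity (suc n)  ∎
  where open ≡-Reasoning

parityℤ-+ : ∀ i j → parityℤ (i + j) ≡ parityℤ i ℙ.+ parityℤ j
parityℤ-+ (+ m)    (+ n)    = ℙ.+-homo-+ m n
parityℤ-+ (+ m)    -[1+ n ] = parityℤ-⊖ m (suc n)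
parityℤ-+ -[1+ m ] (+ n)    = trans (parityℤ-⊖ n (suc m)) (ℙ.+-comm (ℕ.parity n) _)
parityℤ-+ -[1+ m ] -[1+ n ] = trans (ℙ.+-homo-+ m n) (sym (parity-suc+suc m n))

parityℤ-neg : ∀ i → parityℤ (- i) ≡ parityℤ i
parityℤ-neg i = cong ℕ.parity (ℤ.∣-i∣≡∣i∣ i)

parityℤ-* : ∀ i j → parityℤ (i * j) ≡ parityℤ i ℙ.* parityℤ j
parityℤ-* i j = trans (cong ℕ.parity (ℤ.abs-* i j)) (ℙ.*-homo-* ∣ i ∣ ∣ j ∣)

fromParity : Parity → ℤ
fromParity 0ℙ = 0ℤ
fromParity 1ℙ = 1ℤ

parityℤ-fromParity : ∀ p → parityℤ (fromParity p) ≡ p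
parityℤ-fromParity 0ℙ = refl
parityℤ-fromParity 1ℙ = refl

parityℤ-∑ : ∀ m (f : Fin m → ℤ) → parityℤ (∑ m f) ≡ ℙΣ.sum (parityℤ ∘ f)
parityℤ-∑ zero    f = refl
parityℤ-∑ (suc m) f = trans (parityℤ-+ (f zero) _) (cong (ℙ._+_ (parityℤ (f zero))) (parityℤ-∑ m (f ∘ suc)))

Spans : ∀ {m N} → (Fin m → Fin N → Parity) → Set
Spans {m} {N} h = ∀ (x : Fin N → Parity) →
  ∃ λ (c : Fin m → Parity) → ∀ i → x i ≡ ℙΣ.sum (λ t → c t ℙ.* h t i)

¬Spans-without-pivot : ∀ {m N} (h : Fin m → Fin (suc N) → Parity) →
                       ¬ (∃ λ t → h t zero ≡ 1ℙ) → ¬ Spans h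
¬Spans-without-pivot {m} h ∄pivot spans =
  contradiction (proj₂ (spans x) zero) λ 1≡∑ → ℙ.p≢p⁻¹ 0ℙ (sym (trans 1≡∑ ∑≡0))
  where
  x : Fin _ → Parity
  x zero    = 1ℙ
  x (suc _) = 0ℙ
  c = proj₁ (spans x)
  h-zero : ∀ t → h t zero ≡ 0ℙ
  h-zero t with h t zero in eq
  ... | 0ℙ = refl
  ... | 1ℙ = contradiction (t , eq) ∄pivot
  ∑≡0 : ℙΣ.sum (λ t → c t ℙ.* h t zero) ≡ 0ℙ
  ∑≡0 = trans (ℙΣ.sum-cong-≗ (λ t → trans (cong (c t ℙ.*_) (h-zero t)) (ℙ.*-zeroʳ (c t))))
              (ℙΣ.sum-replicate-zero m)

eliminate : ∀ {m N} → (Fin (suc m) → Fin (suc N) → Parity) → Fin (suc m) → Fin m → Fin N → Parity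
eliminate h t₀ s i = h (punchIn t₀ s) (suc i) ℙ.+ (h (punchIn t₀ s) zero ℙ.* h t₀ (suc i))

-- Clearing the first coordinate with the pivot h t₀: a combination c of h that vanishes
-- there has c t₀ = Σ_{s ≠ t₀} c s · h s 0, so c restricted to s ≠ t₀ combines the eliminated rows.
Spans-eliminate : ∀ {m N} (h : Fin (suc m) → Fin (suc N) → Parity) {t₀} → h t₀ zero ≡ 1ℙ →
                  Spans h → Spans (eliminate h t₀)
Spans-eliminate {m} h {t₀} pivot spans x′ with spans (λ { zero → 0ℙ ; (suc i) → x′ i })
... | c , x≡∑ = c ∘ σ , λ i → sym (reconstruct i)
  where
  open ≡-Reasoning
  σ : Fin m → Fin (suc m)
  σ = punchIn t₀
  A : Fin (suc m) → Parity
  A t = c t ℙ.* h t zero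
  Aₜ₀≡cₜ₀ : A t₀ ≡ c t₀
  Aₜ₀≡cₜ₀ = trans (cong (c t₀ ℙ.*_) pivot) (ℙ.*-identityʳ (c t₀))
  ∑Aσ≡cₜ₀ : ℙΣ.sum (A ∘ σ) ≡ c t₀
  ∑Aσ≡cₜ₀ = ℙ.+-cancelˡ-≡ (c t₀) _ _ (begin
    c t₀ ℙ.+ ℙΣ.sum (A ∘ σ)   ≡⟨ cong (ℙ._+ ℙΣ.sum (A ∘ σ)) Aₜ₀≡cₜ₀ ⟨
    A t₀ ℙ.+ ℙΣ.sum (A ∘ σ)   ≡⟨ ℙΣ.sum-remove A ⟨
    ℙΣ.sum A                  ≡⟨ x≡∑ zero ⟨
    0ℙ                        ≡⟨ ℙ.p+p≡0ℙ (c t₀) ⟨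
    c t₀ ℙ.+ c t₀             ∎)
  distrib : ∀ c b a r → c ℙ.* (b ℙ.+ (a ℙ.* r)) ≡ (c ℙ.* b) ℙ.+ (c ℙ.* a ℙ.* r)
  distrib c b a r = trans (ℙ.*-distribˡ-+ c b (a ℙ.* r)) (cong ((c ℙ.* b) ℙ.+_) (sym (ℙ.*-assoc c a r)))
  reconstruct : ∀ i → ℙΣ.sum (λ s → c (σ s) ℙ.* eliminate h t₀ s i) ≡ x′ i
  reconstruct i = begin
    ℙΣ.sum (λ s → c (σ s) ℙ.* eliminate h t₀ s i)
      ≡⟨ ℙΣ.sum-cong-≗ (λ s → distrib (c (σ s)) (h (σ s) (suc i)) (h (σ s) zero) r) ⟩
    ℙΣ.sum (λ s → B (σ s) ℙ.+ (A (σ s) ℙ.* r))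
      ≡⟨ ℙΣ.∑-distrib-+ (B ∘ σ) _ ⟩
    ℙΣ.sum (B ∘ σ) ℙ.+ ℙΣ.sum (λ s → A (σ s) ℙ.* r)
      ≡⟨ cong (ℙΣ.sum (B ∘ σ) ℙ.+_) (ℙΣ.*-distribʳ-sum r (A ∘ σ)) ⟨
    ℙΣ.sum (B ∘ σ) ℙ.+ (ℙΣ.sum (A ∘ σ) ℙ.* r)
      ≡⟨ cong (λ a → ℙΣ.sum (B ∘ σ) ℙ.+ (a ℙ.* r)) ∑Aσ≡cₜ₀ ⟩
    ℙΣ.sum (B ∘ σ) ℙ.+ B t₀
      ≡⟨ ℙ.+-comm (ℙΣ.sum (B ∘ σ)) (B t₀) ⟩
    B t₀ ℙ.+ ℙΣ.sum (B ∘ σ)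
      ≡⟨ ℙΣ.sum-remove B ⟨
    ℙΣ.sum B
      ≡⟨ x≡∑ (suc i) ⟨
    x′ i ∎
    where
    r = h t₀ (suc i)
    B : Fin (suc m) → Parity
    B t = c t ℙ.* h t (suc i)

¬Spans : ∀ {m N} → m < N → (h : Fin m → Fin N → Parity) → ¬ Spans h
¬Spans {zero}  {suc N} _         h spans with proj₂ (spans (λ _ → 1ℙ)) zero
... | ()
¬Spans {suc m} {suc N} (s≤s m<N) h spans with Fin.any? (λ t → h t zero ℙ.≟ 1ℙ)
... | no  ∄pivot        = ¬Spans-without-pivot h ∄pivot spans
... | yes (t₀ , pivot) = ¬Spans m<N (eliminate h t₀) (Spans-eliminate h pivot spans)

starGraph-loopless : ∀ {N} (i : Fin N) → StarGraph N i i ≡ 0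
starGraph-loopless i = cong (if_then 1 else 0) (Bool.xor-same (toℕ i ℕ.≡ᵇ 0))

star-generatedBy : ∀ m → SandpileGeneratedBy (Cone (StarGraph (suc (suc (suc m))))) (suc m)
star-generatedBy m = pendant-generatedBy (StarGraph (suc (suc (suc m)))) {suc zero} {zero} {suc (suc zero)}
  (λ ()) (λ ()) (λ ()) refl leaf refl
  where
  leaf : ∀ w → w ≢ zero → w ≢ suc zero → StarGraph (suc (suc (suc m))) w (suc zero) ≡ 0
  leaf zero    w≢0 _ = contradiction refl w≢0
  leaf (suc w) _   _ = refl

star-leaf-row : ∀ m (y : Fin (suc (suc (suc m))) → ℤ) i →
  parityℤ (∑ _ (λ l → ReducedLaplacian (Cone (StarGraph (suc (suc (suc m))))) (suc i) l * y l))
    ≡ parityℤ (y zero)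
star-leaf-row m y i = begin
  parityℤ (∑ N (λ l → M (suc i) l * y l))
    ≡⟨ cong parityℤ (coneLaplacian-apply S starGraph-loopless y (suc i)) ⟩
  parityℤ (y (suc i) + Δ S y (suc i))
    ≡⟨ cong parityℤ (doubled (y (suc i)) (y zero) _ others≡0) ⟩
  parityℤ (+ 2 * y (suc i) - y zero)
    ≡⟨ parityℤ-+ (+ 2 * y (suc i)) (- y zero) ⟩
  parityℤ (+ 2 * y (suc i)) ℙ.+ parityℤ (- y zero)
    ≡⟨ cong₂ ℙ._+_ (parityℤ-* (+ 2) (y (suc i))) (parityℤ-neg (y zero)) ⟩
  parityℤ (y zero) ∎
  where
  open ≡-Reasoning
  N = suc (suc (suc m))
  S = StarGraph N
  M = ReducedLaplacian (Cone S)
  others≡0 : ∑ (suc (suc m)) (λ l → 0ℤ * (y (suc i) - y (suc l))) ≡ 0ℤ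
  others≡0 = ∑-zero (suc (suc m)) (λ l → ℤ.*-zeroˡ (y (suc i) - y (suc l)))
  doubled : ∀ a b r → r ≡ 0ℤ → a + (1ℤ * (a - b) + r) ≡ + 2 * a - b
  doubled a b r refl = solve′ a b
    where
    solve′ : ∀ a b → a + (1ℤ * (a - b) + 0ℤ) ≡ + 2 * a - b
    solve′ = solve-∀

-- Modulo 2 every leaf row of the reduced Laplacian reads y 0, so together with the
-- parities of k generators the all-ones vector would span Parity^(m + 2).
star-not-generatedBy : ∀ m k → k < suc m → ¬ SandpileGeneratedBy (Cone (StarGraph (suc (suc (suc m))))) k
star-not-generatedBy m k k<1+m (g , generated) = ¬Spans (s≤s k<1+m) h spans
  where
  N = suc (suc (suc m))
  M = ReducedLaplacian (Cone (StarGraph N))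
  h : Fin (suc k) → Fin (suc (suc m)) → Parity
  h zero    _ = 1ℙ
  h (suc t) i = parityℤ (g t (suc i))
  spans : Spans h
  spans x with generated (λ { zero → 0ℤ ; (suc i) → fromParity (x i) })
  ... | c , y , My≡ = (λ { zero → parityℤ (y zero) ; (suc t) → parityℤ (c t) }) , λ i → begin
    x i
      ≡⟨ parityℤ-fromParity (x i) ⟨
    parityℤ (fromParity (x i))
      ≡⟨ cong parityℤ (move (fromParity (x i)) _ _ (My≡ (suc i))) ⟩
    parityℤ (∑ N (λ l → M (suc i) l * y l) + ∑ k (λ t → c t * g t (suc i)))
      ≡⟨ parityℤ-+ (∑ N (λ l → M (suc i) l * y l)) (∑ k (λ t → c t * g t (suc i))) ⟩
    parityℤ (∑ N (λ l → M (suc i) l * y l)) ℙ.+ parityℤ (∑ k (λ t → c t * g t (suc i)))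
      ≡⟨ cong₂ ℙ._+_ (trans (star-leaf-row m y i) (sym (ℙ.*-identityʳ _)))
                     (trans (parityℤ-∑ k _) (ℙΣ.sum-cong-≗ (λ t → parityℤ-* (c t) (g t (suc i))))) ⟩
    parityℤ (y zero) ℙ.* 1ℙ ℙ.+ ℙΣ.sum (λ t → parityℤ (c t) ℙ.* parityℤ (g t (suc i))) ∎
    where
    open ≡-Reasoning
    move : ∀ a b c → b ≡ a - c → a ≡ b + c
    move a b c refl = solve′ a c
      where
      solve′ : ∀ a c → a ≡ a - c + c
      solve′ = solve-∀

Unique⇒lookup-injective : ∀ {A : Set} {xs : List A} → Unique xs →
                          ∀ {i j} → lookup xs i ≡ lookup xs j → i ≡ j
Unique⇒lookup-injective (_  ∷ _) {zero}  {zero}  _  = refl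
Unique⇒lookup-injective (x∉ ∷ _) {zero}  {suc j} eq = contradiction eq (All.lookup x∉ (∈-lookup j))
Unique⇒lookup-injective (x∉ ∷ _) {suc i} {zero}  eq = contradiction (sym eq) (All.lookup x∉ (∈-lookup i))
Unique⇒lookup-injective (_  ∷ u) {suc i} {suc j} eq = cong suc (Unique⇒lookup-injective u eq)

Unique⇒length≤ : ∀ {n} {xs : List (Fin n)} → Unique xs → length xs ≤ n
Unique⇒length≤ u = Fin.injective⇒≤ (Unique⇒lookup-injective u)

Unique-prefix : ∀ {A : Set} (xs : List A) {w ys} → Unique (xs ++ w ∷ ys) → Unique (xs ++ [ w ])
Unique-prefix []       (_  ∷ _) = [] ∷ []
Unique-prefix (x ∷ xs) (x∉ ∷ u) =
  Allₚ.++⁺ (Allₚ.++⁻ˡ xs x∉) (All.head (Allₚ.++⁻ʳ xs x∉) ∷ []) ∷ Unique-prefix xs u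

module _ {n : ℕ} {G : MGraph n} (symmetric : ∀ u v → G u v ≡ G v u) (loopless : ∀ u → G u u ≡ 0) where

  chord-cycle : ∀ {v u w rest} → w ∈ rest → Unique (v ∷ u ∷ rest) →
                Chain G (v ∷ u ∷ rest) → Adj G w v → HasCycle G
  chord-cycle {v} {u} {w} w∈rest unique chain w~v with ∈-∃++ w∈rest
  ... | xs , ys , refl = v , u ∷ xs ++ [ w ] , s≤s (s≤s (List.length-++-≤ʳ [ w ] {xs})) ,
        Unique-prefix (v ∷ u ∷ xs) unique , Chain-close G (v ∷ u ∷ xs) chain w~v

  -- The simple path v ∷ u ∷ rest is extended at its free end v until v is a leaf; a
  -- neighbour of v on the path would close a cycle, and the path cannot outgrow n.
  pendant-at-end : ¬ HasCycle G → ∀ fuel v u rest → Unique (v ∷ u ∷ rest) → Chain G (v ∷ u ∷ rest) →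
                   n < fuel ℕ.+ length (v ∷ u ∷ rest) → ∃ λ ℓ → ∃ λ p → Pendant G ℓ p
  pendant-at-end _ zero v u rest unique _ n<length = contradiction (Unique⇒length≤ unique) (ℕ.<⇒≱ n<length)
  pendant-at-end acyclic (suc fuel) v u rest unique chain n<bound
    with Fin.any? (λ w → (1 ℕ.≤? G v w) ×-dec ¬? (w ≟ u))
  ... | no ∄w = v , u , proj₁ chain , only-u
    where
    only-u : ∀ w → Adj G v w → w ≡ u
    only-u w v~w with w ≟ u
    ... | yes w≡u = w≡u
    ... | no  w≢u = contradiction (w , v~w , w≢u) ∄w
  ... | yes (w , v~w , w≢u) with DecMembership._∈?_ _≟_ w rest
  ...   | no w∉rest = pendant-at-end acyclic fuel w v (u ∷ rest)
            ((Adj-irrefl G loopless v~w ∘ sym ∷ w≢u ∷ Allₚ.¬Any⇒All¬ rest w∉rest) ∷ unique)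
            (Adj-sym G symmetric v~w , chain) (subst (n <_) (sym (ℕ.+-suc fuel _)) n<bound)
  ...   | yes w∈rest = contradiction (chord-cycle w∈rest unique chain (Adj-sym G symmetric v~w)) acyclic

module _ {m : ℕ} {T : MGraph (suc (suc (suc m)))} (tree : IsTree T) where

  private
    symmetric = proj₁ (proj₁ (proj₁ tree))
    loopless  = proj₂ (proj₁ (proj₁ tree))
    simple    = proj₂ (proj₁ tree)
    connected = proj₁ (proj₂ tree)
    acyclic   = proj₂ (proj₂ tree)

  tree-edge : ∃ λ w → Adj T zero w
  tree-edge with connected zero (suc zero)
  ... | step 0~w _ = _ , 0~w

  tree-pendant : ∃ λ ℓ → ∃ λ p → Pendant T ℓ p
  tree-pendant with tree-edge
  ... | w , 0~w = pendant-at-end symmetric loopless acyclic (suc (suc (suc m))) w zero []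
        ((Adj-irrefl T loopless 0~w ∘ sym ∷ []) ∷ [] ∷ [])
        (Adj-sym T symmetric 0~w , _) (ℕ.m<m+n _ (s≤s z≤n))

  tree-generatedBy : SandpileGeneratedBy (Cone T) (suc m)
  tree-generatedBy with tree-pendant
  ... | ℓ , p , ℓ~p , only-p with Fin.any? (λ q → (1 ℕ.≤? T p q) ×-dec ¬? (q ≟ ℓ))
  ...   | yes (q , p~q , q≢ℓ) = pendant-generatedBy T ℓ≢p (q≢ℓ ∘ sym) p≢q
            (edge≡1 (Adj-sym T symmetric ℓ~p)) ℓ-pendant (edge≡1 (Adj-sym T symmetric p~q))
    where
    ℓ≢p = Adj-irrefl T loopless ℓ~p
    p≢q = Adj-irrefl T loopless p~q
    edge≡1 : ∀ {u v} → Adj T u v → T u v ≡ 1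
    edge≡1 {u} {v} = ℕ.≤-antisym (simple u v)
    ℓ-pendant : ∀ w → w ≢ p → w ≢ ℓ → T w ℓ ≡ 0
    ℓ-pendant w w≢p _ = trans (symmetric w ℓ) (ℕ.n<1⇒n≡0 (ℕ.≰⇒> (w≢p ∘ only-p w)))
  -- Otherwise {ℓ, p} is closed under adjacency, yet T has a third vertex r.
  ...   | no ∄q = contradiction (Walk-closed T (λ x → x ≡ ℓ ⊎ x ≡ p) closed (connected ℓ r) (inj₁ refl))
                                (either (skip₂-≢ˡ ℓ≢p zero) (skip₂-≢ʳ ℓ≢p zero))
    where
    ℓ≢p = Adj-irrefl T loopless ℓ~p
    r = skip₂ ℓ≢p zero
    closed : ∀ {x y} → x ≡ ℓ ⊎ x ≡ p → Adj T x y → y ≡ ℓ ⊎ y ≡ p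
    closed (inj₁ refl) ℓ~y = inj₂ (only-p _ ℓ~y)
    closed {y = y} (inj₂ refl) p~y with y ≟ ℓ
    ... | yes y≡ℓ = inj₁ y≡ℓ
    ... | no  y≢ℓ = contradiction (y , p~y , y≢ℓ) ∄q

  tree-not-generatedBy-0 : ¬ SandpileGeneratedBy (Cone T) 0
  tree-not-generatedBy-0 = cone-not-generatedBy-0 T loopless (proj₂ tree-edge)

IsMu-unique : ∀ {n} {G : MGraph (suc n)} {a b} → IsMu G a → IsMu G b → a ≡ b
IsMu-unique {a = a} {b} (gen-a , min-a) (gen-b , min-b) with ℕ.<-cmp a b
... | tri< a<b _ _ = contradiction gen-a (min-b a a<b)
... | tri≈ _ a≡b _ = a≡b
... | tri> _ _ b<a = contradiction gen-b (min-a b b<a)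

IsMu-≤ : ∀ {n} {G : MGraph (suc n)} {μ k} → IsMu G μ → SandpileGeneratedBy G k → μ ≤ k
IsMu-≤ (_ , minimal) gen = ℕ.≮⇒≥ (λ k<μ → minimal _ k<μ gen)

IsMu-positive : ∀ {n} {G : MGraph (suc n)} {μ} → IsMu G μ → ¬ SandpileGeneratedBy G 0 → 1 ≤ μ
IsMu-positive {μ = zero}  (gen , _) nontrivial = contradiction gen nontrivial
IsMu-positive {μ = suc _} _         _          = s≤s z≤n

theorem1p2 : ∀ (n : ℕ) → 3 ≤ n → (T : MGraph n) → IsTree T →
    (∀ (a b c : ℕ) → IsMu (Cone (StarGraph n)) a → IsMu (Cone T) b →
      IsMu (Cone (PathGraph n)) c → (a ≥ b) × (b ≥ c))
    × IsMu (Cone (StarGraph n)) (n ∸ 2)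
    × IsMu (Cone (PathGraph n)) 1
theorem1p2 (suc (suc (suc m))) (s≤s (s≤s (s≤s _))) T tree = bounds , star-μ , path-μ
  where
  N = suc (suc (suc m))
  star-μ : IsMu (Cone (StarGraph N)) (suc m)
  star-μ = star-generatedBy m , star-not-generatedBy m
  path-μ : IsMu (Cone (PathGraph N)) 1
  path-μ = path-generatedBy-1 (suc (suc m)) , λ where
    zero    _        → cone-not-generatedBy-0 (PathGraph N) pathGraph-loopless {zero} {suc zero} (s≤s z≤n)
    (suc _) (s≤s ())
  bounds : ∀ a b c → IsMu (Cone (StarGraph N)) a → IsMu (Cone T) b → IsMu (Cone (PathGraph N)) c →
           (a ≥ b) × (b ≥ c)
  bounds a b c star-a tree-b path-c =
    subst (b ≤_) (IsMu-unique {G = Cone (StarGraph N)} star-μ star-a)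
                 (IsMu-≤ {G = Cone T} tree-b (tree-generatedBy tree)) ,
    subst (_≤ b) (IsMu-unique {G = Cone (PathGraph N)} path-μ path-c)
                 (IsMu-positive {G = Cone T} tree-b (tree-not-generatedBy-0 tree))
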